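{- The QCNFs $\mathtt{Trapdoor}_n$ have constant-size Q-resolution refutations.
   Context: $\mathtt{PHP}^{n+1}_n$ is the CNF in variables $x_{i,j}$ ($i\in[n+1]$, $j\in[n]$) with clauses $\bigvee_{k\in[n]}x_{i,k}$ for $i\in[n+1]$ and $\bar x_{i_1,j}\vee\bar x_{i_2,j}$ for $i_1\neq i_2$, $j\in[n]$. Let $s_n=n(n+1)$ and rename its variables as $x_1,\dots,x_{s_n}$. $\mathtt{Trapdoor}_n$ is the QCNF with prefix $\exists y_1,\dots,y_{s_n}\,\forall w\,\exists t,x_1,\dots,x_{s_n}\,\forall u$ and matrix consisting of $\mathtt{PHP}^{n+1}_n(x_1,\dots,x_{s_n})$ together with, for each $i\in[s_n]$: $\bar y_i\vee x_i\vee u$, $y_i\vee\bar x_i\vee u$, $y_i\vee w\vee t$, $y_i\vee w\vee\bar t$, $\bar y_i\vee w\vee t$, $\bar y_i\vee w\vee\bar t$. Q-resolution. For a QCNF with prefix $Q_1X_1\dots Q_sX_s$, $\mathrm{lv}(x)=i$ if the variable of $x$ lies in $X_i$. $\mathrm{red}(C)$ deletes from a clause $C$ every universal literal $v$ with $\mathrm{lv}(v)>\mathrm{lv}(x)$ for all existential $x\in C$. A Q-resolution refutation is a sequence of clauses ending in the empty clause, each being a matrix clause, a non-tautological resolvent $(C_1\vee\ell)\otimes_\ell(C_2\vee\bar\ell)=C_1\vee C_2$ of two earlier clauses over an existential literal $\ell$, or $\mathrm{red}(C)$ of an earlier clause $C$; its size is the number of clauses. -}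

module Defs where

open import Data.Nat using (ℕ; suc; _<_; _*_)
open import Data.Fin using (Fin)
open import Data.Bool using (Bool; true; false; not)
open import Data.Product using (Σ; ∃; _×_; _,_; proj₁)
open import Data.Sum using (_⊎_)
open import Data.List using (List; []; _∷_; map; length)
open import Data.List.Membership.Propositional using (_∈_)
open import Relation.Nullary using (¬_)
open import Relation.Binary.PropositionalEquality using (_≡_; _≢_)
open import Data.List using (allFin)

-- A literal is a variable with a polarity (true = positive, false = negated).
Lit : Set → Set
Lit V = V × Bool

var : {V : Set} → Lit V → V
var = proj₁

comp : {V : Set} → Lit V → Lit V
comp (v , b) = (v , not b)

-- Clauses are finite lists of literals, read as sets (order and
-- repetitions irrelevant): all conditions below are stated via membership.
Clause : Set → Set
Clause V = List (Lit V)

_⇔_ : Set → Set → Set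
A ⇔ B = (A → B) × (B → A)

_≈C_ : {V : Set} → Clause V → Clause V → Set
C ≈C D = ∀ a → (a ∈ C) ⇔ (a ∈ D)

data Quant : Set where
  ∃Q ∀Q : Quant

-- A QCNF with prefix Q₁X₁ … Q_sX_s: each variable v has its block index
-- lv v and the quantifier of its block quant v; the matrix is given as an
-- indexing type of clauses.
record QCNF : Set₁ where
  field
    Var    : Set
    lv     : Var → ℕ
    quant  : Var → Quant
    MIdx   : Set
    clause : MIdx → Clause Var

module _ (Φ : QCNF) where
  open QCNF Φ

  IsMatrixClause : Clause Var → Set
  IsMatrixClause C = Σ MIdx λ m → C ≈C clause m

  NonTaut : Clause Var → Set
  NonTaut C = ¬ (Σ (Lit Var) λ a → a ∈ C × comp a ∈ C)

  IsResolvent : Clause Var → Clause Var → Lit Var → Clause Var → Set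
  IsResolvent D₁ D₂ ℓ R =
    quant (var ℓ) ≡ ∃Q × ℓ ∈ D₁ × comp ℓ ∈ D₂ × NonTaut R ×
    (∀ a → (a ∈ R) ⇔ ((a ∈ D₁ × a ≢ ℓ) ⊎ (a ∈ D₂ × a ≢ comp ℓ)))

  IsReduct : Clause Var → Clause Var → Set
  IsReduct C R =
    ∀ a → (a ∈ R) ⇔
      (a ∈ C × ¬ (quant (var a) ≡ ∀Q ×
                  (∀ b → b ∈ C → quant (var b) ≡ ∃Q → lv (var b) < lv (var a))))

  Step : List (Clause Var) → Clause Var → Set
  Step prev C =
    IsMatrixClause C
    ⊎ (Σ (Clause Var) λ D₁ → Σ (Clause Var) λ D₂ → Σ (Lit Var) λ ℓ →
         D₁ ∈ prev × D₂ ∈ prev × IsResolvent D₁ D₂ ℓ C)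
    ⊎ (Σ (Clause Var) λ D → D ∈ prev × IsReduct D C)

  -- A Q-resolution derivation, stored in REVERSE order (latest clause first):
  -- every clause is justified by the clauses occurring before it.
  ValidSeq : List (Clause Var) → Set
  ValidSeq [] = Data.Unit.⊤ where import Data.Unit
  ValidSeq (C ∷ earlier) = Step earlier C × ValidSeq earlier

  IsRefutation : List (Clause Var) → Set
  IsRefutation [] = Data.Empty.⊥ where import Data.Empty
  IsRefutation (C ∷ earlier) = ValidSeq (C ∷ earlier) × C ≡ []

-- Variables: x (i , j) with i ∈ [n+1], j ∈ [n] (the s_n = n(n+1) PHP
-- variables, the renaming x_1..x_{s_n} is just this bijection), the matching
-- y (i , j), and w, t, u.
data TVar (n : ℕ) : Set where
  y x   : Fin (suc n) → Fin n → TVar n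
  w t u : TVar n

tlv : {n : ℕ} → TVar n → ℕ
tlv (y _ _) = 1
tlv w       = 2
tlv t       = 3
tlv (x _ _) = 3
tlv u       = 4

tquant : {n : ℕ} → TVar n → Quant
tquant (y _ _) = ∃Q
tquant w       = ∀Q
tquant t       = ∃Q
tquant (x _ _) = ∃Q
tquant u       = ∀Q

data TIdx (n : ℕ) : Set where
  php-row  : Fin (suc n) → TIdx n
  php-hole : (i₁ i₂ : Fin (suc n)) → i₁ ≢ i₂ → Fin n → TIdx n
  c1 c2 c3 c4 c5 c6 : Fin (suc n) → Fin n → TIdx n

pos neg : {V : Set} → V → Lit V
pos v = (v , true)
neg v = (v , false)

tclause : {n : ℕ} → TIdx n → Clause (TVar n)
tclause {n} (php-row i) = map (λ k → pos (x i k)) (allFin n)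
tclause (php-hole i₁ i₂ _ j) = neg (x i₁ j) ∷ neg (x i₂ j) ∷ []
tclause (c1 i j) = neg (y i j) ∷ pos (x i j) ∷ pos u ∷ []
tclause (c2 i j) = pos (y i j) ∷ neg (x i j) ∷ pos u ∷ []
tclause (c3 i j) = pos (y i j) ∷ pos w ∷ pos t ∷ []
tclause (c4 i j) = pos (y i j) ∷ pos w ∷ neg t ∷ []
tclause (c5 i j) = neg (y i j) ∷ pos w ∷ pos t ∷ []
tclause (c6 i j) = neg (y i j) ∷ pos w ∷ neg t ∷ []

Trapdoor : ℕ → QCNF
Trapdoor n = record
  { Var = TVar n ; lv = tlv ; quant = tquant
  ; MIdx = TIdx n ; clause = tclause }

-- For a single y = y₁₁,
-- resolving y ∨ w ∨ t with y ∨ w ∨ t̄ on t gives y ∨ w, whose universal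
-- literal w lies to the right of y and is reduced away, leaving the unit y;
-- symmetrically ȳ ∨ w ∨ t and ȳ ∨ w ∨ t̄ yield ȳ, and one more resolution
-- gives the empty clause: nine clauses for every n ≥ 1.  For n = 0 the
-- pigeonhole row clause is itself empty.
module Submission where

open import Defs
open import Data.Nat using (ℕ; suc; zero; _≤_; _<_; s≤s; z≤n)
open import Data.Nat.Properties using (≤-refl; ≤-trans)
open import Data.Bool using (Bool; true; false)
open import Data.Bool.Properties using (not-¬)
open import Data.Product using (Σ; _×_; _,_; proj₁; proj₂)
open import Data.Sum using (_⊎_; inj₁; inj₂)
open import Data.Unit using (tt)
open import Data.Empty using (⊥-elim)
open import Data.Fin using () renaming (zero to fzero)
open import Data.List using (List; []; _∷_; _∷ʳ_; length)
open import Data.List.Relation.Unary.All using (All; []; _∷_; lookup)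
open import Data.List.Relation.Unary.Any using (here; there)
open import Data.List.Membership.Propositional using (_∈_; _∉_)
open import Data.List.Membership.Propositional.Properties using (∈-++⁺ˡ; ∈-++⁺ʳ; ∈-++⁻)
open import Relation.Binary.PropositionalEquality using (_≡_; _≢_; refl; sym; cong; subst)
open import Function using (id)
open import Relation.Nullary using (¬_)

∈-∷ʳ⁻ : {A : Set} {a b : A} (xs : List A) → a ∈ xs ∷ʳ b → a ∈ xs ⊎ a ≡ b
∈-∷ʳ⁻ xs a∈ with ∈-++⁻ xs a∈
... | inj₁ a∈xs       = inj₁ a∈xs
... | inj₂ (here a≡b) = inj₂ a≡b

∈-∷ʳ : {A : Set} {b : A} (xs : List A) → b ∈ xs ∷ʳ b
∈-∷ʳ xs = ∈-++⁺ʳ xs (here refl)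

≢-comp : {V : Set} (a : Lit V) → a ≢ comp a
≢-comp _ eq = not-¬ refl (cong proj₂ eq)

∃Q≢∀Q : ∃Q ≢ ∀Q
∃Q≢∀Q ()

module _ (Φ : QCNF) where
  open QCNF Φ

  HasRefutationOfSize≤ : ℕ → Set
  HasRefutationOfSize≤ c = Σ (List (Clause Var)) λ π → IsRefutation Φ π × length π ≤ c

  hasRefutationOfSize-mono : ∀ {c d} → c ≤ d → HasRefutationOfSize≤ c → HasRefutationOfSize≤ d
  hasRefutationOfSize-mono c≤d (π , refutes , size≤c) = π , refutes , ≤-trans size≤c c≤d

  matrix-step : ∀ {prev} m → Step Φ prev (clause m)
  matrix-step m = inj₁ (m , λ _ → id , id)

  nonTaut-distinctVars : ∀ {C} → (∀ {a b} → a ∈ C → b ∈ C → var a ≡ var b → a ≡ b) →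
                         NonTaut Φ C
  nonTaut-distinctVars distinct (a , a∈ , ā∈) = ≢-comp a (distinct a∈ ā∈ refl)

  nonTaut-pair : ∀ {a b} → var a ≢ var b → NonTaut Φ (a ∷ b ∷ [])
  nonTaut-pair {a} {b} a≁b = nonTaut-distinctVars distinct
    where
    distinct : ∀ {c d} → c ∈ a ∷ b ∷ [] → d ∈ a ∷ b ∷ [] → var c ≡ var d → c ≡ d
    distinct (here refl)         (here refl)         _  = refl
    distinct (here refl)         (there (here refl)) eq = ⊥-elim (a≁b eq)
    distinct (there (here refl)) (here refl)         eq = ⊥-elim (a≁b (sym eq))
    distinct (there (here refl)) (there (here refl)) _  = refl

  resolvent-∷ʳ : ∀ {D ℓ} → quant (var ℓ) ≡ ∃Q → ℓ ∉ D → NonTaut Φ D →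
                 IsResolvent Φ (D ∷ʳ ℓ) (D ∷ʳ comp ℓ) ℓ D
  resolvent-∷ʳ {D} {ℓ} ∃ℓ ℓ∉D nonTaut =
    ∃ℓ , ∈-∷ʳ D , ∈-∷ʳ D , nonTaut , λ _ → keep , drop
    where
    keep : ∀ {a} → a ∈ D → (a ∈ D ∷ʳ ℓ × a ≢ ℓ) ⊎ (a ∈ D ∷ʳ comp ℓ × a ≢ comp ℓ)
    keep a∈D = inj₁ (∈-++⁺ˡ a∈D , λ { refl → ℓ∉D a∈D })

    drop : ∀ {a} → (a ∈ D ∷ʳ ℓ × a ≢ ℓ) ⊎ (a ∈ D ∷ʳ comp ℓ × a ≢ comp ℓ) → a ∈ D
    drop (inj₁ (a∈ , a≢ℓ)) with ∈-∷ʳ⁻ D a∈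
    ... | inj₁ a∈D = a∈D
    ... | inj₂ a≡ℓ = ⊥-elim (a≢ℓ a≡ℓ)
    drop (inj₂ (a∈ , a≢ℓ̄)) with ∈-∷ʳ⁻ D a∈
    ... | inj₁ a∈D = a∈D
    ... | inj₂ a≡ℓ̄ = ⊥-elim (a≢ℓ̄ a≡ℓ̄)

  Reducible : Clause Var → Lit Var → Set
  Reducible C a = quant (var a) ≡ ∀Q ×
                  (∀ b → b ∈ C → quant (var b) ≡ ∃Q → lv (var b) < lv (var a))

  ExistentialBelow : Var → Lit Var → Set
  ExistentialBelow v b = quant (var b) ≡ ∃Q × lv (var b) < lv v

  reduct-∷ʳ : ∀ {D ℓ} → quant (var ℓ) ≡ ∀Q → All (ExistentialBelow (var ℓ)) D →
              IsReduct Φ (D ∷ʳ ℓ) D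
  reduct-∷ʳ {D} {ℓ} ∀ℓ below a = keep , drop
    where
    keep : a ∈ D → a ∈ D ∷ʳ ℓ × ¬ Reducible (D ∷ʳ ℓ) a
    keep a∈D = ∈-++⁺ˡ a∈D , λ (∀a , _) →
      ∃Q≢∀Q (subst (_≡ ∀Q) (proj₁ (lookup below a∈D)) ∀a)

    ℓ-reducible : Reducible (D ∷ʳ ℓ) ℓ
    ℓ-reducible = ∀ℓ , below-ℓ
      where
      below-ℓ : ∀ b → b ∈ D ∷ʳ ℓ → quant (var b) ≡ ∃Q → lv (var b) < lv (var ℓ)
      below-ℓ b b∈ ∃b with ∈-∷ʳ⁻ D b∈
      ... | inj₁ b∈D  = proj₂ (lookup below b∈D)
      ... | inj₂ refl = ⊥-elim (∃Q≢∀Q (subst (_≡ ∀Q) ∃b ∀ℓ))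

    drop : a ∈ D ∷ʳ ℓ × ¬ Reducible (D ∷ʳ ℓ) a → a ∈ D
    drop (a∈ , irreducible) with ∈-∷ʳ⁻ D a∈
    ... | inj₁ a∈D  = a∈D
    ... | inj₂ refl = ⊥-elim (irreducible ℓ-reducible)

module _ (m : ℕ) where
  private
    Φ : QCNF
    Φ = Trapdoor (suc m)

    Y : TVar (suc m)
    Y = y fzero fzero

    y-unit : Bool → Clause (TVar (suc m))
    y-unit b = (Y , b) ∷ []

    y∨w : Bool → Clause (TVar (suc m))
    y∨w b = (Y , b) ∷ pos w ∷ []

    y∨w-resolvent : ∀ b → IsResolvent Φ (y∨w b ∷ʳ pos t) (y∨w b ∷ʳ neg t) (pos t) (y∨w b)
    y∨w-resolvent b = resolvent-∷ʳ Φ refl (λ { (here ()) ; (there (here ())) ; (there (there ())) })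
                        (nonTaut-pair Φ λ ())

    y-reduct : ∀ b → IsReduct Φ (y∨w b) (y-unit b)
    y-reduct b = reduct-∷ʳ Φ refl ((refl , s≤s (s≤s z≤n)) ∷ [])

    empty-resolvent : IsResolvent Φ (y-unit true) (y-unit false) (pos Y) []
    empty-resolvent = resolvent-∷ʳ Φ refl (λ ()) (λ { (_ , () , _) })

    -- listed latest clause first, as IsRefutation expects
    refutation : List (Clause (TVar (suc m)))
    refutation =
      [] ∷ y-unit false ∷ y∨w false ∷ tclause (c6 fzero fzero) ∷ tclause (c5 fzero fzero) ∷
      y-unit true ∷ y∨w true ∷ tclause (c4 fzero fzero) ∷ tclause (c3 fzero fzero) ∷ []

  trapdoor-suc-refutation : HasRefutationOfSize≤ (Trapdoor (suc m)) 9
  trapdoor-suc-refutation = refutation , valid , ≤-refl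
    where
    valid : IsRefutation Φ refutation
    valid =
      ( inj₂ (inj₁ (_ , _ , _ , there (there (there (there (here refl)))) , here refl , empty-resolvent))
      , inj₂ (inj₂ (_ , here refl , y-reduct false))
      , inj₂ (inj₁ (_ , _ , _ , there (here refl) , here refl , y∨w-resolvent false))
      , matrix-step Φ (c6 fzero fzero)
      , matrix-step Φ (c5 fzero fzero)
      , inj₂ (inj₂ (_ , here refl , y-reduct true))
      , inj₂ (inj₁ (_ , _ , _ , there (here refl) , here refl , y∨w-resolvent true))
      , matrix-step Φ (c4 fzero fzero)
      , matrix-step Φ (c3 fzero fzero)
      , tt ) , refl

trapdoor-zero-refutation : HasRefutationOfSize≤ (Trapdoor zero) 1
trapdoor-zero-refutation = [] ∷ [] , ((matrix-step (Trapdoor zero) (php-row fzero) , tt) , refl) , ≤-refl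

proposition4p7 : Σ ℕ λ c → (n : ℕ) →
    Σ (List (Clause (QCNF.Var (Trapdoor n)))) λ π →
    IsRefutation (Trapdoor n) π × length π ≤ c
proposition4p7 = 9 , λ where
  zero    → hasRefutationOfSize-mono (Trapdoor zero) (s≤s z≤n) trapdoor-zero-refutation
  (suc m) → trapdoor-suc-refutation m
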